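{- Let $r\ge 2$ and $k\ge 1$ be integers, and let $G$ be an $r$-partite graph on $rk$ vertices whose vertex set is the disjoint union of $r$ independent sets $V_1,V_2,\dots,V_r$, each of cardinality $k$. Suppose that for each $1\le i<j\le r$, $$|E(V_i,V_j)| > k^2\left(1-\frac{1}{e(2r-3)}\right).$$ Then $G$ contains the complete graph $K_r$ as an induced subgraph.
   Context: Graphs are undirected. For $V_1,V_2\subset V$, $E(V_1,V_2)$ is the set of edges $\{v_1,v_2\}$ of $G$ with $v_1\in V_1$, $v_2\in V_2$. A set of vertices is independent if no edge joins two of its elements. An induced subgraph is obtained by taking a subset of vertices and all edges of $G$ between them; $K_r$ is the complete graph on $r$ vertices. Here $e$ is Euler's number. -}

module Defs where

open import Data.Nat using (ℕ; zero; suc; _+_; _*_; _∸_; _<_; _≤_)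
open import Data.Nat using (_!)
open import Data.Fin using (Fin; zero; suc)
open import Data.Bool using (Bool; true; false; if_then_else_)
open import Data.Product using (_×_; _,_; Σ; ∃-syntax)
open import Relation.Binary.PropositionalEquality using (_≡_; _≢_)
open import Function.Definitions using (Injective)

sumFin : (n : ℕ) → (Fin n → ℕ) → ℕ
sumFin zero    f = 0
sumFin (suc n) f = f zero + sumFin n (λ x → f (suc x))

-- Vertex set of an r-partite graph with r parts of size k:
-- vertex (i , a) is the a-th vertex of the part V_i.
Vtx : ℕ → ℕ → Set
Vtx r k = Fin r × Fin k

record PartiteGraph (r k : ℕ) : Set where
  field
    adj         : Vtx r k → Vtx r k → Bool
    adj-sym     : ∀ u v → adj u v ≡ adj v u
    adj-irrefl  : ∀ v → adj v v ≡ false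
    independent : ∀ i a b → adj (i , a) (i , b) ≡ false

open PartiteGraph public

edgesBetween : ∀ {r k} → PartiteGraph r k → Fin r → Fin r → ℕ
edgesBetween {r} {k} G i j =
  sumFin k (λ a → sumFin k (λ b → if adj G (i , a) (j , b) then 1 else 0))

-- Euler's number, via the exact upper bounds
--   e < u_n := Σ_{i=0}^{n} 1/i! + 1/(n!·n)   (n ≥ 1),  u_n ↓ e.
-- With A n = Σ_{i=0}^{n} n!/i!  (a natural number), u_n = (n·A n + 1)/(n!·n).
-- Hence for naturals a, b:   e·a < b  ⇔  ∃ n ≥ 1, a·(n·A n + 1) < b·(n!·n).
A : ℕ → ℕ
A zero    = 1
A (suc n) = suc n * A n + 1

e*_<_ : ℕ → ℕ → Set
e* a < b = ∃[ n ] (1 ≤ n × a * (n * A n + 1) < b * ((n !) * n))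

-- G contains K_r as an induced subgraph: r distinct vertices that are
-- pairwise adjacent (the induced subgraph on them is then complete).
HasInducedK : ∀ {r k} → PartiteGraph r k → (m : ℕ) → Set
HasInducedK {r} {k} G m =
  Σ (Fin m → Vtx r k) λ f →
    Injective _≡_ _≡_ f × (∀ x y → x ≢ y → adj G (f x) (f y) ≡ true)

{-# OPTIONS --safe #-}
-- Pick one vertex f(i) ∈ V_i in every part, uniformly at random.  The choice f spans
-- a K_r iff it avoids every event B_ij = "f(i) ≁ f(j)".  The event B_ij is determined
-- by the coordinates i and j, so it is mutually independent of the family of events
-- B_ab with {a,b} ∩ {i,j} = ∅, and it shares a coordinate with only d = 2r − 4 other
-- events.  With p = P(B_ij) = (k² − |E(V_i,V_j)|)/k² the hypothesis reads
-- e·p·(d+1) < 1, and since (1 + 1/d)^d < e this gives p ≤ d^d/(d+1)^(d+1), the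
-- condition of the symmetric Lovász Local Lemma.  Its inductive proof,
-- P(B_ij | no event of S occurs) ≤ 1/(d+1) for every set S of events, goes through
-- with probabilities replaced by numbers of choice functions.  For r = 2 the
-- hypothesis just says E(V_1,V_2) ≠ ∅.
module Submission where

open import Defs
open import Data.Nat using (ℕ; zero; suc; _+_; _*_; _∸_; _^_; _!; _≤_; _<_; _≤′_; ≤′-refl; ≤′-step;
  z≤n; s≤s; z<s; _<?_; _<ᵇ_; _≡ᵇ_; NonZero; >-nonZero; >-nonZero⁻¹)
open import Data.Nat.Properties hiding (_≟_)
open import Algebra.Bundles using (CommutativeSemiring)
open import Algebra.Definitions.RawSemiring (CommutativeSemiring.rawSemiring +-*-commutativeSemiring)
  using (sum) renaming (_^_ to _^ᴿ_; _×_ to _×ᴿ_)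
import Algebra.Properties.CommutativeSemiring.Binomial +-*-commutativeSemiring as Binomial
open import Algebra.Properties.CommutativeSemigroup *-commutativeSemigroup
  using (x∙yz≈y∙xz; xy∙z≈xz∙y; xy∙z≈y∙xz)
open import Algebra.Properties.CommutativeSemigroup +-commutativeSemigroup
  using () renaming (interchange to +-interchange)
open import Data.Bool using (Bool; true; false; if_then_else_; _∧_; _∨_; not; T)
open import Data.Bool.Properties using (T?; T-∧; T-∨; T-≡)
open import Data.Fin using (Fin; zero; suc; toℕ; fromℕ<)
open import Data.Fin.Properties using (all?; any?; _≟_; toℕ<n; toℕ-injective; toℕ-fromℕ<)
open import Data.Fin.Subset using (Subset; _∈_; _∉_; inside; outside; ⁅_⁆; _∪_)
import Data.Fin.Subset as Subset
open import Data.Fin.Subset.Properties using (_∈?_; x∈p∪q⁺; x∈p∪q⁻; x∈⁅x⁆; x∈⁅y⁆⇒x≡y; x∉p⇒x∈∁p)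
open import Data.Nat.Combinatorics using (_C_; nCk≡nC[n∸k]; nCk+nC[k+1]≡[n+1]C[k+1]; nC1≡n;
  [n-k]*[n-k-1]!≡[n-k]!)
open import Data.Nat.Combinatorics.Base using (_P′_)
open import Data.Nat.Induction using (<-wellFounded)
open import Data.Nat.Tactic.RingSolver using (solve-∀)
open import Data.Product using (_×_; _,_; proj₁; proj₂; map₂; ∃-syntax)
open import Data.Sum using (_⊎_; inj₁; inj₂; [_,_]′)
import Data.Sum as Sum
open import Data.Unit using (tt)
import Data.Vec.Base as Vec
open Vec using (here; there)
open import Data.Vec.Functional using (Vector; []; _∷_)
open import Function using (_∘_; case_of_)
open import Function.Bundles using (Equivalence; _⇔_; mk⇔)
open import Induction.WellFounded using (module All)
open import Level using (0ℓ)
import Relation.Binary.Construct.On as On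
open import Relation.Binary.PropositionalEquality
open import Relation.Nullary using (Dec; yes; no; does; ¬_; ¬?; contradiction)
open import Relation.Nullary.Decidable using (dec-true; dec-false; does-⇔; _→-dec_; _×-dec_; _⊎-dec_)
open import Relation.Unary using (Pred; Decidable; _∩_; ∁)
open import Relation.Unary.Properties using (_∩?_; ∁?)

sumFin-cong : ∀ n {f g : Fin n → ℕ} → (∀ x → f x ≡ g x) → sumFin n f ≡ sumFin n g
sumFin-cong zero    f≗g = refl
sumFin-cong (suc n) f≗g = cong₂ _+_ (f≗g zero) (sumFin-cong n (f≗g ∘ suc))

sumFin-mono : ∀ n {f g : Fin n → ℕ} → (∀ x → f x ≤ g x) → sumFin n f ≤ sumFin n g
sumFin-mono zero    f≤g = ≤-refl
sumFin-mono (suc n) f≤g = +-mono-≤ (f≤g zero) (sumFin-mono n (f≤g ∘ suc))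

sumFin-strictMono : ∀ n {f g : Fin n → ℕ} → (∀ x → f x ≤ g x) → ∀ x → f x < g x →
                    sumFin n f < sumFin n g
sumFin-strictMono (suc n) f≤g zero    fx<gx = +-mono-<-≤ fx<gx (sumFin-mono n (f≤g ∘ suc))
sumFin-strictMono (suc n) f≤g (suc x) fx<gx = +-mono-≤-< (f≤g zero) (sumFin-strictMono n (f≤g ∘ suc) x fx<gx)

sumFin-positive : ∀ n (f : Fin n → ℕ) → 0 < sumFin n f → ∃[ x ] 0 < f x
sumFin-positive (suc n) f Σf>0 with f zero in f₀≡
... | suc _ = zero , subst (0 <_) (sym f₀≡) z<s
... | zero  = let x , fx>0 = sumFin-positive n (f ∘ suc) Σf>0 in suc x , fx>0

sumFin-+ : ∀ n (f g : Fin n → ℕ) → sumFin n (λ x → f x + g x) ≡ sumFin n f + sumFin n g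
sumFin-+ zero    f g = refl
sumFin-+ (suc n) f g = trans (cong (f zero + g zero +_) (sumFin-+ n (f ∘ suc) (g ∘ suc)))
                             (+-interchange (f zero) (g zero) _ _)

sumFin-*ˡ : ∀ n c (f : Fin n → ℕ) → sumFin n (λ x → c * f x) ≡ c * sumFin n f
sumFin-*ˡ zero    c f = sym (*-zeroʳ c)
sumFin-*ˡ (suc n) c f = trans (cong (c * f zero +_) (sumFin-*ˡ n c (f ∘ suc))) (sym (*-distribˡ-+ c _ _))

sumFin-*ʳ : ∀ n c (f : Fin n → ℕ) → sumFin n (λ x → f x * c) ≡ sumFin n f * c
sumFin-*ʳ n c f = trans (sumFin-cong n (λ x → *-comm (f x) c)) (trans (sumFin-*ˡ n c f) (*-comm c _))

sumFin-const : ∀ n c → sumFin n (λ _ → c) ≡ n * c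
sumFin-const zero    c = refl
sumFin-const (suc n) c = cong (c +_) (sumFin-const n c)

sumFin-swap : ∀ m n (h : Fin m → Fin n → ℕ) →
              sumFin m (λ a → sumFin n (h a)) ≡ sumFin n (λ b → sumFin m (λ a → h a b))
sumFin-swap zero    n h = sym (trans (sumFin-const n 0) (*-zeroʳ n))
sumFin-swap (suc m) n h = trans (cong (sumFin n (h zero) +_) (sumFin-swap m n (h ∘ suc)))
                                (sym (sumFin-+ n (h zero) (λ b → sumFin m (λ a → h (suc a) b))))

sumFin-*-constantʳ : ∀ n (f g : Fin n → ℕ) → (∀ a b → g a ≡ g b) →
                     n * sumFin n (λ a → f a * g a) ≡ sumFin n f * sumFin n g
sumFin-*-constantʳ n f g g-constant = begin
  n * sumFin n (λ a → f a * g a)      ≡⟨ sumFin-*ˡ n n (λ a → f a * g a) ⟨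
  sumFin n (λ a → n * (f a * g a))    ≡⟨ sumFin-cong n (λ a → x∙yz≈y∙xz n (f a) (g a)) ⟩
  sumFin n (λ a → f a * (n * g a))    ≡⟨ sumFin-cong n (λ a → cong (f a *_) (Σg≡n*g a)) ⟨
  sumFin n (λ a → f a * sumFin n g)   ≡⟨ sumFin-*ʳ n (sumFin n g) f ⟩
  sumFin n f * sumFin n g             ∎
  where
  open ≡-Reasoning
  Σg≡n*g : ∀ a → sumFin n g ≡ n * g a
  Σg≡n*g a = trans (sumFin-cong n (λ b → g-constant b a)) (sumFin-const n (g a))

sumFin≡sum : ∀ n (f : Fin n → ℕ) → sumFin n f ≡ sum f
sumFin≡sum zero    f = refl
sumFin≡sum (suc n) f = cong (f zero +_) (sumFin≡sum n (f ∘ suc))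

^ᴿ≡^ : ∀ x n → x ^ᴿ n ≡ x ^ n
^ᴿ≡^ x zero    = refl
^ᴿ≡^ x (suc n) = cong (x *_) (^ᴿ≡^ x n)

×ᴿ≡* : ∀ m x → m ×ᴿ x ≡ m * x
×ᴿ≡* zero    x = refl
×ᴿ≡* (suc m) x = cong (x +_) (×ᴿ≡* m x)

binomial-theorem : ∀ n x y →
                   (x + y) ^ n ≡ sumFin (suc n) (λ k → (n C toℕ k) * (x ^ toℕ k * y ^ (n ∸ toℕ k)))
binomial-theorem n x y = begin
  (x + y) ^ n
    ≡⟨ ^ᴿ≡^ (x + y) n ⟨
  (x + y) ^ᴿ n
    ≡⟨ Binomial.theorem n x y ⟩
  Binomial.binomialExpansion x y n
    ≡⟨ sumFin≡sum (suc n) (λ k → (n C toℕ k) ×ᴿ (x ^ᴿ toℕ k * y ^ᴿ (n ∸ toℕ k))) ⟨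
  sumFin (suc n) (λ k → (n C toℕ k) ×ᴿ (x ^ᴿ toℕ k * y ^ᴿ (n ∸ toℕ k)))
    ≡⟨ sumFin-cong (suc n) (λ k → trans (×ᴿ≡* (n C toℕ k) _)
         (cong₂ (λ a b → (n C toℕ k) * (a * b)) (^ᴿ≡^ x (toℕ k)) (^ᴿ≡^ y (n ∸ toℕ k)))) ⟩
  sumFin (suc n) (λ k → (n C toℕ k) * (x ^ toℕ k * y ^ (n ∸ toℕ k))) ∎
  where open ≡-Reasoning

[1+k]*[1+n]C[1+k]≡[1+n]*nCk : ∀ n k → suc k * (suc n C suc k) ≡ suc n * (n C k)
[1+k]*[1+n]C[1+k]≡[1+n]*nCk zero    zero    = refl
[1+k]*[1+n]C[1+k]≡[1+n]*nCk zero    (suc k) = *-zeroʳ (2 + k)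
[1+k]*[1+n]C[1+k]≡[1+n]*nCk (suc n) zero    = trans (*-identityˡ _) (trans (nC1≡n (2 + n)) (sym (*-identityʳ _)))
[1+k]*[1+n]C[1+k]≡[1+n]*nCk (suc n) (suc k) = begin
  suc k′ * (suc n′ C suc k′)                    ≡⟨ cong (suc k′ *_) (nCk+nC[k+1]≡[n+1]C[k+1] n′ k′) ⟨
  suc k′ * (n′ C k′ + n′ C suc k′)              ≡⟨ distrib k′ (n′ C k′) (n′ C suc k′) ⟩
  n′ C k′ + (k′ * (n′ C k′) + suc k′ * (n′ C suc k′))
    ≡⟨ cong₂ (λ a b → n′ C k′ + (a + b)) ([1+k]*[1+n]C[1+k]≡[1+n]*nCk n k)
                                          ([1+k]*[1+n]C[1+k]≡[1+n]*nCk n k′) ⟩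
  n′ C k′ + (n′ * (n C k) + n′ * (n C k′))      ≡⟨ cong (n′ C k′ +_) (*-distribˡ-+ n′ (n C k) (n C k′)) ⟨
  n′ C k′ + n′ * (n C k + n C k′)               ≡⟨ cong (λ a → n′ C k′ + n′ * a) (nCk+nC[k+1]≡[n+1]C[k+1] n k) ⟩
  n′ C k′ + n′ * (n′ C k′)                      ∎
  where
  open ≡-Reasoning
  n′ = suc n
  k′ = suc k
  distrib : ∀ k a b → suc k * (a + b) ≡ a + (k * a + suc k * b)
  distrib = solve-∀

nCk*k!≤n^k : ∀ n k → (n C k) * k ! ≤ n ^ k
nCk*k!≤n^k n       zero    = ≤-refl
nCk*k!≤n^k zero    (suc k) = z≤n
nCk*k!≤n^k (suc n) (suc k) = begin
  (suc n C suc k) * (suc k * k !)   ≡⟨ x∙yz≈y∙xz (suc n C suc k) (suc k) (k !) ⟩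
  suc k * ((suc n C suc k) * k !)   ≡⟨ *-assoc (suc k) (suc n C suc k) (k !) ⟨
  suc k * (suc n C suc k) * k !     ≡⟨ cong (_* k !) ([1+k]*[1+n]C[1+k]≡[1+n]*nCk n k) ⟩
  suc n * (n C k) * k !             ≡⟨ *-assoc (suc n) (n C k) (k !) ⟩
  suc n * ((n C k) * k !)           ≤⟨ *-monoʳ-≤ (suc n) (nCk*k!≤n^k n k) ⟩
  suc n * n ^ k                     ≤⟨ *-monoʳ-≤ (suc n) (^-monoˡ-≤ k (n≤1+n n)) ⟩
  suc n * suc n ^ k                 ∎
  where open ≤-Reasoning

[1+n]P′[1+k]≡[1+n]*nP′k : ∀ n k → suc n P′ suc k ≡ suc n * (n P′ k)
[1+n]P′[1+k]≡[1+n]*nP′k n zero    = refl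
[1+n]P′[1+k]≡[1+n]*nP′k n (suc k) = begin
  (n ∸ k) * (suc n P′ suc k)     ≡⟨ cong ((n ∸ k) *_) ([1+n]P′[1+k]≡[1+n]*nP′k n k) ⟩
  (n ∸ k) * (suc n * (n P′ k))   ≡⟨ x∙yz≈y∙xz (n ∸ k) (suc n) (n P′ k) ⟩
  suc n * ((n ∸ k) * (n P′ k))   ∎
  where open ≡-Reasoning

nP′k*[n∸k]!≡n! : ∀ {n} k → k ≤ n → (n P′ k) * (n ∸ k) ! ≡ n !
nP′k*[n∸k]!≡n! zero          _   = *-identityˡ _
nP′k*[n∸k]!≡n! {n} (suc k) k<n = begin
  (n ∸ k) * (n P′ k) * (n ∸ suc k) !     ≡⟨ xy∙z≈y∙xz (n ∸ k) (n P′ k) ((n ∸ suc k) !) ⟩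
  (n P′ k) * ((n ∸ k) * (n ∸ suc k) !)   ≡⟨ cong ((n P′ k) *_) ([n-k]*[n-k-1]!≡[n-k]! k<n) ⟩
  (n P′ k) * (n ∸ k) !                   ≡⟨ nP′k*[n∸k]!≡n! k (<⇒≤ k<n) ⟩
  n !                                    ∎
  where open ≡-Reasoning

sumFin-nP′k≡A : ∀ n → sumFin (suc n) (λ k → n P′ toℕ k) ≡ A n
sumFin-nP′k≡A zero    = refl
sumFin-nP′k≡A (suc n) = begin
  1 + sumFin (suc n) (λ k → suc n P′ suc (toℕ k))
    ≡⟨ cong (1 +_) (sumFin-cong (suc n) (λ k → [1+n]P′[1+k]≡[1+n]*nP′k n (toℕ k))) ⟩
  1 + sumFin (suc n) (λ k → suc n * (n P′ toℕ k))
    ≡⟨ cong (1 +_) (sumFin-*ˡ (suc n) (suc n) (λ k → n P′ toℕ k)) ⟩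
  1 + suc n * sumFin (suc n) (λ k → n P′ toℕ k)
    ≡⟨ cong (λ a → 1 + suc n * a) (sumFin-nP′k≡A n) ⟩
  1 + suc n * A n
    ≡⟨ +-comm 1 _ ⟩
  suc n * A n + 1 ∎
  where open ≡-Reasoning

binomialTerm*d!≤d^d*dP′k : ∀ {d} k → k ≤ d → (d C k) * (d ^ k * 1 ^ (d ∸ k)) * d ! ≤ d ^ d * (d P′ k)
binomialTerm*d!≤d^d*dP′k {d} k k≤d = begin
  (d C k) * (d ^ k * 1 ^ (d ∸ k)) * d !
    ≡⟨ cong₂ (λ c e → c * (d ^ k * e) * d !) (nCk≡nC[n∸k] k≤d) (^-zeroˡ (d ∸ k)) ⟩
  (d C (d ∸ k)) * (d ^ k * 1) * d !
    ≡⟨ cong ((d C (d ∸ k)) * (d ^ k * 1) *_) (nP′k*[n∸k]!≡n! k k≤d) ⟨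
  (d C (d ∸ k)) * (d ^ k * 1) * ((d P′ k) * (d ∸ k) !)
    ≡⟨ rearrange (d C (d ∸ k)) (d ^ k) (d P′ k) ((d ∸ k) !) ⟩
  (d C (d ∸ k)) * (d ∸ k) ! * (d ^ k * (d P′ k))
    ≤⟨ *-monoˡ-≤ (d ^ k * (d P′ k)) (nCk*k!≤n^k d (d ∸ k)) ⟩
  d ^ (d ∸ k) * (d ^ k * (d P′ k))
    ≡⟨ *-assoc (d ^ (d ∸ k)) (d ^ k) (d P′ k) ⟨
  d ^ (d ∸ k) * d ^ k * (d P′ k)
    ≡⟨ cong (_* (d P′ k)) (^-distribˡ-+-* d (d ∸ k) k) ⟨
  d ^ (d ∸ k + k) * (d P′ k)
    ≡⟨ cong (λ e → d ^ e * (d P′ k)) (m∸n+n≡m k≤d) ⟩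
  d ^ d * (d P′ k) ∎
  where
  open ≤-Reasoning
  rearrange : ∀ c x p f → c * (x * 1) * (p * f) ≡ c * f * (x * p)
  rearrange = solve-∀

-- (a , b) ≤ᶠ (c , e) says a/b ≤ c/e.
infix 4 _≤ᶠ_

data _≤ᶠ_ : ℕ × ℕ → ℕ × ℕ → Set where
  *≤* : ∀ {a b c e} → a * e ≤ c * b → (a , b) ≤ᶠ (c , e)

≤ᶠ-trans : ∀ {x y z} → 0 < proj₂ y → x ≤ᶠ y → y ≤ᶠ z → x ≤ᶠ z
≤ᶠ-trans {a , b} {c , e} {g , h} e>0 (*≤* ae≤cb) (*≤* ch≤ge) =
  *≤* (*-cancelʳ-≤ (a * h) (g * b) e {{>-nonZero e>0}} (begin
    a * h * e   ≡⟨ xy∙z≈xz∙y a h e ⟩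
    a * e * h   ≤⟨ *-monoˡ-≤ h ae≤cb ⟩
    c * b * h   ≡⟨ xy∙z≈xz∙y c b h ⟩
    c * h * b   ≤⟨ *-monoˡ-≤ b ch≤ge ⟩
    g * e * b   ≡⟨ xy∙z≈xz∙y g e b ⟩
    g * b * e   ∎))
  where open ≤-Reasoning

≤ᶠ-ascending : (s : ℕ → ℕ × ℕ) → (∀ n → 0 < proj₂ (s n)) → (∀ n → s n ≤ᶠ s (suc n)) →
               ∀ {m n} → m ≤′ n → s m ≤ᶠ s n
≤ᶠ-ascending s pos step ≤′-refl            = *≤* ≤-refl
≤ᶠ-ascending s pos step (≤′-step {n} m≤′n) = ≤ᶠ-trans (pos n) (≤ᶠ-ascending s pos step m≤′n) (step n)

≤ᶠ-descending : (s : ℕ → ℕ × ℕ) → (∀ n → 0 < proj₂ (s n)) → (∀ n → s (suc n) ≤ᶠ s n) →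
                ∀ {m n} → m ≤′ n → s n ≤ᶠ s m
≤ᶠ-descending s pos step ≤′-refl            = *≤* ≤-refl
≤ᶠ-descending s pos step (≤′-step {n} m≤′n) = ≤ᶠ-trans (pos n) (step n) (≤ᶠ-descending s pos step m≤′n)

n!>0 : ∀ n → 0 < n !
n!>0 n = >-nonZero⁻¹ (n !) {{n !≢0}}

-- Σ_{i ≤ n} 1/i! and the bound u_n > e of Defs, as fractions.
partialSum upperBound : ℕ → ℕ × ℕ
partialSum n = A n , n !
upperBound n = n * A n + 1 , n ! * n

-- Expand (d + 1)^d binomially and compare termwise: C(d,k)·d^k ≤ d^d/(d−k)!.
[1+1/d]^d≤ᶠpartialSum : ∀ d → (suc d ^ d , d ^ d) ≤ᶠ partialSum d
[1+1/d]^d≤ᶠpartialSum d = *≤* (begin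
  suc d ^ d * d !
    ≡⟨ cong (λ x → x ^ d * d !) (+-comm 1 d) ⟩
  (d + 1) ^ d * d !
    ≡⟨ cong (_* d !) (binomial-theorem d d 1) ⟩
  sumFin (suc d) (λ k → (d C toℕ k) * (d ^ toℕ k * 1 ^ (d ∸ toℕ k))) * d !
    ≡⟨ sumFin-*ʳ (suc d) (d !) (λ k → (d C toℕ k) * (d ^ toℕ k * 1 ^ (d ∸ toℕ k))) ⟨
  sumFin (suc d) (λ k → (d C toℕ k) * (d ^ toℕ k * 1 ^ (d ∸ toℕ k)) * d !)
    ≤⟨ sumFin-mono (suc d) (λ k → binomialTerm*d!≤d^d*dP′k (toℕ k) (≤-pred (toℕ<n k))) ⟩
  sumFin (suc d) (λ k → d ^ d * (d P′ toℕ k))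
    ≡⟨ sumFin-*ˡ (suc d) (d ^ d) (λ k → d P′ toℕ k) ⟩
  d ^ d * sumFin (suc d) (λ k → d P′ toℕ k)
    ≡⟨ cong (d ^ d *_) (sumFin-nP′k≡A d) ⟩
  d ^ d * A d
    ≡⟨ *-comm (d ^ d) (A d) ⟩
  A d * d ^ d ∎)
  where open ≤-Reasoning

partialSum-ascending : ∀ n → partialSum n ≤ᶠ partialSum (suc n)
partialSum-ascending n = *≤* (begin
  A n * (suc n * n !)       ≡⟨ x∙yz≈y∙xz (A n) (suc n) (n !) ⟩
  suc n * (A n * n !)       ≡⟨ *-assoc (suc n) (A n) (n !) ⟨
  suc n * A n * n !         ≤⟨ *-monoˡ-≤ (n !) (m≤m+n (suc n * A n) 1) ⟩
  (suc n * A n + 1) * n !   ∎)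
  where open ≤-Reasoning

upperBound-descending : ∀ n → upperBound (suc n) ≤ᶠ upperBound n
upperBound-descending n = *≤* (begin
  (suc n * A (suc n) + 1) * (n ! * n)         ≤⟨ m≤m+n _ (n !) ⟩
  (suc n * A (suc n) + 1) * (n ! * n) + n !   ≡⟨ expand n (A n) (n !) ⟩
  (n * A n + 1) * (suc n ! * suc n)           ∎)
  where
  open ≤-Reasoning
  expand : ∀ n a f → (suc n * (suc n * a + 1) + 1) * (f * n) + f ≡ (n * a + 1) * ((suc n * f) * suc n)
  expand = solve-∀

partialSum≤ᶠupperBound : ∀ n → partialSum n ≤ᶠ upperBound n
partialSum≤ᶠupperBound n = *≤* (begin
  A n * (n ! * n)         ≤⟨ m≤m+n _ (n !) ⟩
  A n * (n ! * n) + n !   ≡⟨ expand (A n) (n !) n ⟩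
  (n * A n + 1) * n !     ∎)
  where
  open ≤-Reasoning
  expand : ∀ a f n → a * (f * n) + f ≡ (n * a + 1) * f
  expand = solve-∀

partialSum≤ᶠupperBound[1+n] : ∀ m n → partialSum m ≤ᶠ upperBound (suc n)
partialSum≤ᶠupperBound[1+n] m n with ≤-total m (suc n)
... | inj₁ m≤1+n =
  ≤ᶠ-trans (n!>0 (suc n)) (≤ᶠ-ascending partialSum n!>0 partialSum-ascending (≤⇒≤′ m≤1+n))
                          (partialSum≤ᶠupperBound (suc n))
... | inj₂ (s≤s {n = m′} n≤m′) =
  ≤ᶠ-trans (upperBound-denominator>0 m′) (partialSum≤ᶠupperBound m)
    (≤ᶠ-descending (upperBound ∘ suc) upperBound-denominator>0 (upperBound-descending ∘ suc) (≤⇒≤′ n≤m′))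
  where
  upperBound-denominator>0 : ∀ n → 0 < suc n ! * suc n
  upperBound-denominator>0 n = *-mono-< (n!>0 (suc n)) z<s

[1+d]^[1+d]*m≤K*d^d : ∀ d m K → e* (suc d * m) < K → suc d ^ suc d * m ≤ K * d ^ d
[1+d]^[1+d]*m≤K*d^d d m K (suc n , _ , lt) = *-cancelʳ-≤ _ _ u {{u≢0}} (begin
  suc d * suc d ^ d * m * u     ≡⟨ rearrange (suc d) (suc d ^ d) m u ⟩
  suc d ^ d * (suc d * m * u)   ≤⟨ *-monoʳ-≤ (suc d ^ d) (<⇒≤ lt) ⟩
  suc d ^ d * (K * v)           ≡⟨ x∙yz≈y∙xz (suc d ^ d) K v ⟩
  K * (suc d ^ d * v)           ≤⟨ *-monoʳ-≤ K [1+1/d]^d≤u/v ⟩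
  K * (u * d ^ d)               ≡⟨ cong (K *_) (*-comm u (d ^ d)) ⟩
  K * (d ^ d * u)               ≡⟨ *-assoc K (d ^ d) u ⟨
  K * d ^ d * u                 ∎)
  where
  open ≤-Reasoning
  u = suc n * A (suc n) + 1
  v = suc n ! * suc n
  u≢0 : NonZero u
  u≢0 = >-nonZero (m≤n+m 1 _)
  [1+1/d]^d≤u/v : suc d ^ d * v ≤ u * d ^ d
  [1+1/d]^d≤u/v with ≤ᶠ-trans (n!>0 d) ([1+1/d]^d≤ᶠpartialSum d) (partialSum≤ᶠupperBound[1+n] d n)
  ... | *≤* le = le
  rearrange : ∀ D P m Q → D * P * m * Q ≡ P * (D * m * Q)
  rearrange = solve-∀

n!≤A : ∀ n → n ! ≤ A n
n!≤A zero    = ≤-refl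
n!≤A (suc n) = ≤-trans (*-monoʳ-≤ (suc n) (n!≤A n)) (m≤m+n _ 1)

e*a<b⇒a<b : ∀ a b → e* a < b → a < b
e*a<b⇒a<b a b (n , _ , lt) = *-cancelʳ-< (n * A n + 1) a b (<-≤-trans lt (*-monoʳ-≤ b n!*n≤n*A+1))
  where
  n!*n≤n*A+1 : n ! * n ≤ n * A n + 1
  n!*n≤n*A+1 = ≤-trans (≤-reflexive (*-comm (n !) n)) (≤-trans (*-monoʳ-≤ n (n!≤A n)) (m≤m+n _ 1))

𝟙 : Bool → ℕ
𝟙 b = if b then 1 else 0

𝟙-∧ : ∀ x y → 𝟙 (x ∧ y) ≡ 𝟙 x * 𝟙 y
𝟙-∧ true  y = sym (+-identityʳ (𝟙 y))
𝟙-∧ false y = refl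

𝟙>0⇒T : ∀ x → 0 < 𝟙 x → T x
𝟙>0⇒T true  _  = tt
𝟙>0⇒T false ()

𝟙-∧-≤ : ∀ x y → 𝟙 (x ∧ y) ≤ 𝟙 x
𝟙-∧-≤ true  true  = ≤-refl
𝟙-∧-≤ true  false = z≤n
𝟙-∧-≤ false y     = z≤n

𝟙-split : ∀ x y → 𝟙 x ≡ 𝟙 (x ∧ y) + 𝟙 (x ∧ not y)
𝟙-split true  true  = refl
𝟙-split true  false = refl
𝟙-split false y     = refl

𝟙-not : ∀ x → 𝟙 (not x) + 𝟙 x ≡ 1
𝟙-not true  = refl
𝟙-not false = refl

𝟙-<ᵇ-suc : ∀ x t → 𝟙 (x <ᵇ suc t) ≡ 𝟙 (x ≡ᵇ t) + 𝟙 (x <ᵇ t)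
𝟙-<ᵇ-suc zero    zero    = refl
𝟙-<ᵇ-suc zero    (suc t) = refl
𝟙-<ᵇ-suc (suc x) zero    = refl
𝟙-<ᵇ-suc (suc x) (suc t) = 𝟙-<ᵇ-suc x t

T-does : ∀ {P : Set} (P? : Dec P) → T (does P?) ⇔ P
T-does (yes p) = mk⇔ (λ _ → p) (λ _ → tt)
T-does (no ¬p) = mk⇔ (λ ()) ¬p

𝟙-does-mono : ∀ {P Q : Set} → (P → Q) → (P? : Dec P) (Q? : Dec Q) → 𝟙 (does P?) ≤ 𝟙 (does Q?)
𝟙-does-mono P→Q (yes p) Q? = ≤-reflexive (cong 𝟙 (sym (dec-true Q? (P→Q p))))
𝟙-does-mono P→Q (no _)  Q? = z≤n

refute : ∀ {X Y : Set} → Dec X → ¬ (X → Y) → X × ¬ Y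
refute (yes x) ¬[X→Y] = x , λ y → ¬[X→Y] (λ _ → y)
refute (no ¬x) ¬[X→Y] = contradiction (λ x → contradiction x ¬x) ¬[X→Y]

module ProductSpace (k : ℕ) where

  ΣΩ : ∀ n → (Vector (Fin k) n → ℕ) → ℕ
  ΣΩ zero    F = F []
  ΣΩ (suc n) F = sumFin k (λ a → ΣΩ n (λ f → F (a ∷ f)))

  ΣΩ-cong : ∀ n {F H : Vector (Fin k) n → ℕ} → (∀ f → F f ≡ H f) → ΣΩ n F ≡ ΣΩ n H
  ΣΩ-cong zero    F≗H = F≗H []
  ΣΩ-cong (suc n) F≗H = sumFin-cong k (λ a → ΣΩ-cong n (λ f → F≗H (a ∷ f)))

  ΣΩ-mono : ∀ n {F H : Vector (Fin k) n → ℕ} → (∀ f → F f ≤ H f) → ΣΩ n F ≤ ΣΩ n H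
  ΣΩ-mono zero    F≤H = F≤H []
  ΣΩ-mono (suc n) F≤H = sumFin-mono k (λ a → ΣΩ-mono n (λ f → F≤H (a ∷ f)))

  ΣΩ-+ : ∀ n (F H : Vector (Fin k) n → ℕ) → ΣΩ n (λ f → F f + H f) ≡ ΣΩ n F + ΣΩ n H
  ΣΩ-+ zero    F H = refl
  ΣΩ-+ (suc n) F H = trans (sumFin-cong k (λ a → ΣΩ-+ n (λ f → F (a ∷ f)) (λ f → H (a ∷ f))))
                           (sumFin-+ k _ _)

  ΣΩ-const : ∀ n c → ΣΩ n (λ _ → c) ≡ k ^ n * c
  ΣΩ-const zero    c = sym (+-identityʳ c)
  ΣΩ-const (suc n) c = begin
    sumFin k (λ _ → ΣΩ n (λ _ → c))   ≡⟨ sumFin-cong k (λ _ → ΣΩ-const n c) ⟩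
    sumFin k (λ _ → k ^ n * c)        ≡⟨ sumFin-const k (k ^ n * c) ⟩
    k * (k ^ n * c)                   ≡⟨ *-assoc k (k ^ n) c ⟨
    k * k ^ n * c                     ∎
    where open ≡-Reasoning

  ΣΩ-positive : ∀ n (F : Vector (Fin k) n → ℕ) → 0 < ΣΩ n F → ∃[ f ] 0 < F f
  ΣΩ-positive zero    F ΣF>0 = [] , ΣF>0
  ΣΩ-positive (suc n) F ΣF>0 =
    let a , Σ>0 = sumFin-positive k _ ΣF>0
        f , F>0 = ΣΩ-positive n (λ f → F (a ∷ f)) Σ>0
    in a ∷ f , F>0

  DependsOn : ∀ {n} → Subset n → (Vector (Fin k) n → ℕ) → Set
  DependsOn I F = ∀ f g → (∀ {x} → x ∈ I → f x ≡ g x) → F f ≡ F g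

  DependsOn-tail : ∀ {n s} {I : Subset n} {F} → DependsOn (s Vec.∷ I) F → ∀ a → DependsOn I (λ f → F (a ∷ f))
  DependsOn-tail F∼ a f g f≈g = F∼ (a ∷ f) (a ∷ g) λ { here → refl ; (there x∈I) → f≈g x∈I }

  DependsOn-head : ∀ {n} {I : Subset n} {F} → DependsOn (outside Vec.∷ I) F → ∀ a b f → F (a ∷ f) ≡ F (b ∷ f)
  DependsOn-head F∼ a b f = F∼ (a ∷ f) (b ∷ f) λ { (there _) → refl }

  ΣΩ-independent : ∀ {n} (I : Subset n) (F H : Vector (Fin k) n → ℕ) →
                   DependsOn I F → DependsOn (Subset.∁ I) H →
                   k ^ n * ΣΩ n (λ f → F f * H f) ≡ ΣΩ n F * ΣΩ n H
  ΣΩ-independent Vec.[]              F H _  _  = *-identityˡ _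
  ΣΩ-independent {suc n} (s Vec.∷ I) F H F∼ H∼ = begin
    k * k ^ n * sumFin k Z             ≡⟨ *-assoc k (k ^ n) _ ⟩
    k * (k ^ n * sumFin k Z)           ≡⟨ cong (k *_) (sumFin-*ˡ k (k ^ n) Z) ⟨
    k * sumFin k (λ a → k ^ n * Z a)   ≡⟨ cong (k *_) (sumFin-cong k λ a →
                                            ΣΩ-independent I _ _ (DependsOn-tail F∼ a) (DependsOn-tail H∼ a)) ⟩
    k * sumFin k (λ a → X a * Y a)     ≡⟨ split-head s F∼ H∼ ⟩
    sumFin k X * sumFin k Y            ∎
    where
    open ≡-Reasoning
    X Y Z : Fin k → ℕ
    X a = ΣΩ n (λ f → F (a ∷ f))
    Y a = ΣΩ n (λ f → H (a ∷ f))
    Z a = ΣΩ n (λ f → F (a ∷ f) * H (a ∷ f))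
    constant : ∀ {J G} → DependsOn (outside Vec.∷ J) G → ∀ a b → ΣΩ n (λ f → G (a ∷ f)) ≡ ΣΩ n (λ f → G (b ∷ f))
    constant G∼ a b = ΣΩ-cong n (DependsOn-head G∼ a b)
    split-head : ∀ s → DependsOn (s Vec.∷ I) F → DependsOn (Subset.∁ (s Vec.∷ I)) H →
                 k * sumFin k (λ a → X a * Y a) ≡ sumFin k X * sumFin k Y
    split-head inside  _  H∼ = sumFin-*-constantʳ k X Y (constant H∼)
    split-head outside F∼ _  = begin
      k * sumFin k (λ a → X a * Y a)   ≡⟨ cong (k *_) (sumFin-cong k (λ a → *-comm (X a) (Y a))) ⟩
      k * sumFin k (λ a → Y a * X a)   ≡⟨ sumFin-*-constantʳ k Y X (constant F∼) ⟩
      sumFin k Y * sumFin k X          ≡⟨ *-comm (sumFin k Y) _ ⟩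
      sumFin k X * sumFin k Y          ∎

  ΣΩ-coordinate : ∀ n (x : Fin n) (h : Fin k → ℕ) → k * ΣΩ n (λ f → h (f x)) ≡ k ^ n * sumFin k h
  ΣΩ-coordinate (suc n) zero h = begin
    k * sumFin k (λ a → ΣΩ n (λ _ → h a))   ≡⟨ cong (k *_) (sumFin-cong k (λ a → ΣΩ-const n (h a))) ⟩
    k * sumFin k (λ a → k ^ n * h a)        ≡⟨ cong (k *_) (sumFin-*ˡ k (k ^ n) h) ⟩
    k * (k ^ n * sumFin k h)                ≡⟨ *-assoc k (k ^ n) _ ⟨
    k * k ^ n * sumFin k h                  ∎
    where open ≡-Reasoning
  ΣΩ-coordinate (suc n) (suc x) h = begin
    k * sumFin k (λ _ → ΣΩ n (λ f → h (f x)))   ≡⟨ cong (k *_) (sumFin-const k _) ⟩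
    k * (k * ΣΩ n (λ f → h (f x)))              ≡⟨ cong (k *_) (ΣΩ-coordinate n x h) ⟩
    k * (k ^ n * sumFin k h)                    ≡⟨ *-assoc k (k ^ n) _ ⟨
    k * k ^ n * sumFin k h                      ∎
    where open ≡-Reasoning

  ΣΩ-pair : ∀ n {x y : Fin n} → x ≢ y → (h : Fin k → Fin k → ℕ) →
            k * k * ΣΩ n (λ f → h (f x) (f y)) ≡ k ^ n * sumFin k (λ a → sumFin k (h a))
  ΣΩ-pair (suc n) {zero}  {zero}  x≢y h = contradiction refl x≢y
  ΣΩ-pair (suc n) {zero}  {suc y} x≢y h = begin
    k * k * sumFin k (λ a → ΣΩ n (λ f → h a (f y)))     ≡⟨ *-assoc k k _ ⟩
    k * (k * sumFin k (λ a → ΣΩ n (λ f → h a (f y))))   ≡⟨ cong (k *_) (sumFin-*ˡ k k _) ⟨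
    k * sumFin k (λ a → k * ΣΩ n (λ f → h a (f y)))
      ≡⟨ cong (k *_) (sumFin-cong k (λ a → ΣΩ-coordinate n y (h a))) ⟩
    k * sumFin k (λ a → k ^ n * sumFin k (h a))         ≡⟨ cong (k *_) (sumFin-*ˡ k (k ^ n) _) ⟩
    k * (k ^ n * sumFin k (λ a → sumFin k (h a)))       ≡⟨ *-assoc k (k ^ n) _ ⟨
    k * k ^ n * sumFin k (λ a → sumFin k (h a))         ∎
    where open ≡-Reasoning
  ΣΩ-pair (suc n) {suc x} {zero}  x≢y h = begin
    k * k * ΣΩ (suc n) (λ f → h (f (suc x)) (f zero))     ≡⟨ ΣΩ-pair (suc n) (x≢y ∘ sym) (λ b a → h a b) ⟩
    k * k ^ n * sumFin k (λ b → sumFin k (λ a → h a b))   ≡⟨ cong (k * k ^ n *_) (sumFin-swap k k h) ⟨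
    k * k ^ n * sumFin k (λ a → sumFin k (h a))           ∎
    where open ≡-Reasoning
  ΣΩ-pair (suc n) {suc x} {suc y} x≢y h = begin
    k * k * sumFin k (λ _ → ΣΩ n (λ f → h (f x) (f y)))   ≡⟨ cong (k * k *_) (sumFin-const k _) ⟩
    k * k * (k * ΣΩ n (λ f → h (f x) (f y)))              ≡⟨ x∙yz≈y∙xz (k * k) k _ ⟩
    k * (k * k * ΣΩ n (λ f → h (f x) (f y)))              ≡⟨ cong (k *_) (ΣΩ-pair n (x≢y ∘ cong suc) h) ⟩
    k * (k ^ n * sumFin k (λ a → sumFin k (h a)))         ≡⟨ *-assoc k (k ^ n) _ ⟨
    k * k ^ n * sumFin k (λ a → sumFin k (h a))           ∎
    where open ≡-Reasoning

  count : ∀ {n} {P : Pred (Vector (Fin k) n) 0ℓ} → Decidable P → ℕ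
  count {n} P? = ΣΩ n (λ f → 𝟙 (does (P? f)))

  module _ {n} {P : Pred (Vector (Fin k) n) 0ℓ} (P? : Decidable P) where

    count-mono : ∀ {Q} (Q? : Decidable Q) → (∀ f → P f → Q f) → count P? ≤ count Q?
    count-mono Q? P⊆Q = ΣΩ-mono n (λ f → 𝟙-does-mono (P⊆Q f) (P? f) (Q? f))

    count-split : ∀ {Q} (Q? : Decidable Q) → count P? ≡ count (P? ∩? Q?) + count (P? ∩? ∁? Q?)
    count-split Q? = trans (ΣΩ-cong n (λ f → 𝟙-split (does (P? f)) (does (Q? f)))) (ΣΩ-+ n _ _)

    count-all : (∀ f → P f) → count P? ≡ k ^ n
    count-all all-P = begin
      ΣΩ n (λ f → 𝟙 (does (P? f)))   ≡⟨ ΣΩ-cong n (λ f → cong 𝟙 (dec-true (P? f) (all-P f))) ⟩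
      ΣΩ n (λ _ → 1)                 ≡⟨ ΣΩ-const n 1 ⟩
      k ^ n * 1                      ≡⟨ *-identityʳ (k ^ n) ⟩
      k ^ n                          ∎
      where open ≡-Reasoning

    count-none : (∀ f → ¬ P f) → count P? ≡ 0
    count-none no-P = begin
      ΣΩ n (λ f → 𝟙 (does (P? f)))   ≡⟨ ΣΩ-cong n (λ f → cong 𝟙 (dec-false (P? f) (no-P f))) ⟩
      ΣΩ n (λ _ → 0)                 ≡⟨ ΣΩ-const n 0 ⟩
      k ^ n * 0                      ≡⟨ *-zeroʳ (k ^ n) ⟩
      0                              ∎
      where open ≡-Reasoning

    count-positive : 0 < count P? → ∃[ f ] P f
    count-positive count>0 with ΣΩ-positive n _ count>0
    ... | f , 𝟙>0 with P? f
    ...   | yes p = f , p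

module Choices {r k : ℕ} (G : PartiteGraph r k) where

  open ProductSpace k public

  Choice : Set
  Choice = Vector (Fin k) r

  Adj : Choice → Fin r → Fin r → Set
  Adj f a b = T (adj G (a , f a) (b , f b))

  Adj? : ∀ f a b → Dec (Adj f a b)
  Adj? f a b = T? _

  Adj-sym : ∀ {f a b} → Adj f a b → Adj f b a
  Adj-sym {f} {a} {b} = subst T (adj-sym G (a , f a) (b , f b))

  Adj-irrefl : ∀ {f a} → ¬ Adj f a a
  Adj-irrefl {f} {a} = subst T (adj-irrefl G (a , f a))

  complete⇒inducedK : ∀ f → (∀ a b → a ≢ b → Adj f a b) → HasInducedK G r
  complete⇒inducedK f adjacent =
    (λ x → x , f x) , cong proj₁ , λ x y x≢y → Equivalence.to T-≡ (adjacent x y x≢y)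

  nonEdges : Fin r → Fin r → ℕ
  nonEdges i j = sumFin k (λ a → sumFin k (λ b → 𝟙 (not (adj G (i , a) (j , b)))))

  nonEdges≡k²∸edgesBetween : ∀ i j → nonEdges i j ≡ k * k ∸ edgesBetween G i j
  nonEdges≡k²∸edgesBetween i j = begin
    nonEdges i j                                             ≡⟨ m+n∸n≡m (nonEdges i j) (edgesBetween G i j) ⟨
    nonEdges i j + edgesBetween G i j ∸ edgesBetween G i j   ≡⟨ cong (_∸ edgesBetween G i j) nonEdges+edges≡k² ⟩
    k * k ∸ edgesBetween G i j                               ∎
    where
    open ≡-Reasoning
    adjᵢⱼ : Fin k → Fin k → Bool
    adjᵢⱼ a b = adj G (i , a) (j , b)
    nonEdges+edges≡k² : nonEdges i j + edgesBetween G i j ≡ k * k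
    nonEdges+edges≡k² = begin
      nonEdges i j + edgesBetween G i j
        ≡⟨ sumFin-+ k _ _ ⟨
      sumFin k (λ a → sumFin k (λ b → 𝟙 (not (adjᵢⱼ a b))) + sumFin k (λ b → 𝟙 (adjᵢⱼ a b)))
        ≡⟨ sumFin-cong k (λ a → sumFin-+ k _ _) ⟨
      sumFin k (λ a → sumFin k (λ b → 𝟙 (not (adjᵢⱼ a b)) + 𝟙 (adjᵢⱼ a b)))
        ≡⟨ sumFin-cong k (λ a → sumFin-cong k (λ b → 𝟙-not (adjᵢⱼ a b))) ⟩
      sumFin k (λ _ → sumFin k (λ _ → 1))
        ≡⟨ sumFin-cong k (λ _ → trans (sumFin-const k 1) (*-identityʳ k)) ⟩
      sumFin k (λ _ → k)
        ≡⟨ sumFin-const k k ⟩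
      k * k ∎

  -- A constraint set S stands for the set of events {B_ab : S a b}.
  Constraints : Set
  Constraints = Fin r → Fin r → Bool

  Avoids : Constraints → Pred Choice 0ℓ
  Avoids S f = ∀ a b → T (S a b) → Adj f a b

  Avoids? : ∀ S → Decidable (Avoids S)
  Avoids? S f = all? λ a → all? λ b → T? (S a b) →-dec Adj? f a b

  Bad? : ∀ S i j → Decidable (Avoids S ∩ ∁ (λ f → Adj f i j))
  Bad? S i j = Avoids? S ∩? ∁? (λ f → Adj? f i j)

  #Avoids : Constraints → ℕ
  #Avoids S = count (Avoids? S)

  #Bad : Constraints → Fin r → Fin r → ℕ
  #Bad S i j = count (Bad? S i j)

  size : Constraints → ℕ
  size S = sumFin r (λ a → sumFin r (λ b → 𝟙 (S a b)))

  size-rec : ∀ {ℓ} (Q : Constraints → Set ℓ) → (∀ S → (∀ U → size U < size S → Q U) → Q S) → ∀ S → Q S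
  size-rec {ℓ} Q step = All.wfRec (On.wellFounded size <-wellFounded) ℓ Q (λ S ih → step S (λ U → ih))

  infixl 5 _↾_

  _↾_ : Constraints → {R : Fin r → Fin r → Set} → (∀ a b → Dec (R a b)) → Constraints
  (S ↾ R?) a b = S a b ∧ does (R? a b)

  module _ (S : Constraints) {R : Fin r → Fin r → Set} (R? : ∀ a b → Dec (R a b)) where

    ↾⁻ : ∀ {a b} → T ((S ↾ R?) a b) → T (S a b) × R a b
    ↾⁻ {a} {b} S∧R = map₂ (Equivalence.to (T-does (R? a b))) (Equivalence.to T-∧ S∧R)

    Avoids-↾⁺ : ∀ {f} → (∀ a b → T (S a b) → R a b → Adj f a b) → Avoids (S ↾ R?) f
    Avoids-↾⁺ avoids a b S∧R = let s , r = ↾⁻ S∧R in avoids a b s r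

    Avoids-↾⁻ : ∀ {f} → Avoids (S ↾ R?) f → ∀ a b → T (S a b) → R a b → Adj f a b
    Avoids-↾⁻ avoids a b s r = avoids a b (Equivalence.from T-∧ (s , Equivalence.from (T-does (R? a b)) r))

    Avoids-↾ : ∀ {f} → Avoids S f → Avoids (S ↾ R?) f
    Avoids-↾ avoids = Avoids-↾⁺ λ a b s _ → avoids a b s

    size-↾< : ∀ {a b} → T (S a b) → ¬ R a b → size (S ↾ R?) < size S
    size-↾< {a} {b} s ¬r =
      sumFin-strictMono r (λ x → sumFin-mono r (λ y → 𝟙-∧-≤ (S x y) _)) a
        (sumFin-strictMono r (λ y → 𝟙-∧-≤ (S a y) _) b
          (subst₂ (λ x y → 𝟙 (x ∧ y) < 𝟙 x) (sym (Equivalence.to T-≡ s)) (sym (dec-false (R? a b) ¬r)) ≤-refl))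

  -- The local lemma's induction hypothesis: P(B_ij | f avoids S) ≤ 1/(d+1).
  Claim : ℕ → Constraints → Set
  Claim d S = ∀ i j → i ≢ j → suc d * #Bad S i j ≤ #Avoids S

  -- #Avoids V ≥ #Avoids U − #Bad U p q ≥ (1 − 1/(d+1)) · #Avoids U.
  claim-step : ∀ d U V {p q} → Claim d U → p ≢ q → (∀ f → Avoids U f → Adj f p q → Avoids V f) →
               d * #Avoids U ≤ suc d * #Avoids V
  claim-step d U V {p} {q} claim p≢q extend = +-cancelˡ-≤ (#Avoids U) _ _ (begin
    suc d * #Avoids U                          ≡⟨ cong (suc d *_) (count-split (Avoids? U) Adj?-pq) ⟩
    suc d * (#Good + #Bad U p q)               ≡⟨ *-distribˡ-+ (suc d) #Good _ ⟩
    suc d * #Good + suc d * #Bad U p q         ≤⟨ +-mono-≤ (*-monoʳ-≤ (suc d) #Good≤#Avoids-V) (claim p q p≢q) ⟩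
    suc d * #Avoids V + #Avoids U              ≡⟨ +-comm _ (#Avoids U) ⟩
    #Avoids U + suc d * #Avoids V              ∎)
    where
    open ≤-Reasoning
    Adj?-pq : Decidable (λ f → Adj f p q)
    Adj?-pq f = Adj? f p q
    #Good : ℕ
    #Good = count (Avoids? U ∩? Adj?-pq)
    #Good≤#Avoids-V : #Good ≤ #Avoids V
    #Good≤#Avoids-V = count-mono (Avoids? U ∩? Adj?-pq) (Avoids? V) (λ f (avoids , adj) → extend f avoids adj)

module LocalLemma {r k : ℕ} (G : PartiteGraph r k) (d : ℕ) (k≥1 : 1 ≤ k) (d≥1 : 1 ≤ d)
  (2r≡d+4 : 2 * r ≡ d + 4)
  (sparse : ∀ i j → i ≢ j → suc d ^ suc d * Choices.nonEdges G i j ≤ k * k * d ^ d) where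

  open Choices G

  module InductionStep (S : Constraints) (ih : ∀ U → size U < size S → Claim d U) where

    -- If S constrains {p,q}, the induction hypothesis applies to S ↾ P, which misses that constraint.
    grow : ∀ {P Q : Fin r → Fin r → Set} (P? : ∀ a b → Dec (P a b)) (Q? : ∀ a b → Dec (Q a b)) {p q} →
           p ≢ q → ¬ P p q → ¬ P q p →
           (∀ f → Avoids (S ↾ P?) f → (T (S p q) ⊎ T (S q p) → Adj f p q) → Avoids (S ↾ Q?) f) →
           d * #Avoids (S ↾ P?) ≤ suc d * #Avoids (S ↾ Q?)
    grow P? Q? {p} {q} p≢q ¬Ppq ¬Pqp extend with T? (S p q) ⊎-dec T? (S q p)
    ... | yes S∋pq = claim-step d (S ↾ P?) (S ↾ Q?) (ih (S ↾ P?) smaller) p≢q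
                       (λ f avoids adj → extend f avoids (λ _ → adj))
      where
      smaller : size (S ↾ P?) < size S
      smaller = [ (λ s → size-↾< S P? s ¬Ppq) , (λ s → size-↾< S P? s ¬Pqp) ]′ S∋pq
    ... | no  S∌pq = *-mono-≤ (n≤1+n d) (count-mono (Avoids? (S ↾ P?)) (Avoids? (S ↾ Q?))
                       (λ f avoids → extend f avoids (λ s → contradiction s S∌pq)))

    module Neighbourhood (i j : Fin r) (i≢j : i ≢ j) where

      I : Subset r
      I = ⁅ i ⁆ ∪ ⁅ j ⁆

      i∈I : i ∈ I
      i∈I = x∈p∪q⁺ (inj₁ (x∈⁅x⁆ i))

      j∈I : j ∈ I
      j∈I = x∈p∪q⁺ (inj₂ (x∈⁅x⁆ j))

      ∈I⁻ : ∀ {x} → x ∈ I → x ≡ i ⊎ x ≡ j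
      ∈I⁻ x∈I = Sum.map (x∈⁅y⁆⇒x≡y i) (x∈⁅y⁆⇒x≡y j) (x∈p∪q⁻ ⁅ i ⁆ ⁅ j ⁆ x∈I)

      NoConstraintInside : Set
      NoConstraintInside = ∀ a b → a ∈ I → b ∈ I → ¬ T (S a b)

      -- S[ t ] drops the constraints of S joining I to a vertex of index ≥ t, so S[ 0 ] is
      -- independent of B_ij, S[ r ] is S, and S[ t + 1 ] adds to S[ t ] at most the two
      -- neighbours B_it and B_jt of B_ij.
      Revealed : ℕ → Fin r → Fin r → Set
      Revealed t a b = (a ∈ I → toℕ b < t) × (b ∈ I → toℕ a < t)

      revealed? : ∀ t a b → Dec (Revealed t a b)
      revealed? t a b = ((a ∈? I) →-dec (toℕ b <? t)) ×-dec ((b ∈? I) →-dec (toℕ a <? t))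

      S[_] : ℕ → Constraints
      S[ t ] = S ↾ revealed? t

      Edge : Fin r → Fin r → Fin r → Fin r → Set
      Edge p q a b = (a ≡ p × b ≡ q) ⊎ (a ≡ q × b ≡ p)

      edge? : ∀ p q a b → Dec (Edge p q a b)
      edge? p q a b = ((a ≟ p) ×-dec (b ≟ q)) ⊎-dec ((a ≟ q) ×-dec (b ≟ p))

      not-yet-revealed : ∀ {t} {l p : Fin r} → toℕ l ≡ t → p ∈ I → ¬ Revealed t p l × ¬ Revealed t l p
      not-yet-revealed l≡t p∈I = (λ (l<t , _) → <-irrefl l≡t (l<t p∈I)) , (λ (_ , l<t) → <-irrefl l≡t (l<t p∈I))

      at-threshold : ∀ {t} {l x : Fin r} → toℕ l ≡ t → toℕ x < suc t → ¬ toℕ x < t → x ≡ l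
      at-threshold l≡t x<1+t x≮t with m<1+n⇒m<n∨m≡n x<1+t
      ... | inj₁ x<t = contradiction x<t x≮t
      ... | inj₂ x≡t = toℕ-injective (trans x≡t (sym l≡t))

      newly-revealed : ∀ {t} {l a b : Fin r} → toℕ l ≡ t → Revealed (suc t) a b → ¬ Revealed t a b →
                       (a ∈ I × b ≡ l) ⊎ (b ∈ I × a ≡ l)
      newly-revealed {t} {l} {a} {b} l≡t (b<1+t , a<1+t) ¬revealed with (a ∈? I) →-dec (toℕ b <? t)
      ... | no ¬[a∈I→b<t] =
        let a∈I , b≮t = refute (a ∈? I) ¬[a∈I→b<t] in inj₁ (a∈I , at-threshold {x = b} l≡t (b<1+t a∈I) b≮t)
      ... | yes a∈I→b<t =
        let b∈I , a≮t = refute (b ∈? I) (λ b∈I→a<t → ¬revealed (a∈I→b<t , b∈I→a<t)) in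
        inj₂ (b∈I , at-threshold {x = a} l≡t (a<1+t b∈I) a≮t)

      reveal-inside : ∀ {t l} → toℕ l ≡ t → l ∈ I → NoConstraintInside →
                      ∀ f → Avoids S[ t ] f → Avoids S[ suc t ] f
      reveal-inside {t} l≡t l∈I none f avoids = Avoids-↾⁺ S (revealed? (suc t)) λ a b s revealed →
        case revealed? t a b of λ where
          (yes revealed′) → Avoids-↾⁻ S (revealed? t) avoids a b s revealed′
          (no ¬revealed)  → case newly-revealed l≡t revealed ¬revealed of λ where
            (inj₁ (a∈I , refl)) → contradiction s (none a b a∈I l∈I)
            (inj₂ (b∈I , refl)) → contradiction s (none a b l∈I b∈I)

      reveal-outside : ∀ {t l} → toℕ l ≡ t → l ∉ I →
                       d * (d * #Avoids S[ t ]) ≤ suc d * (suc d * #Avoids S[ suc t ])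
      reveal-outside {t} {l} l≡t l∉I = begin
        d * (d * #Avoids S[ t ])               ≤⟨ *-monoʳ-≤ d add-il ⟩
        d * (suc d * #Avoids S′)               ≡⟨ x∙yz≈y∙xz d (suc d) (#Avoids S′) ⟩
        suc d * (d * #Avoids S′)               ≤⟨ *-monoʳ-≤ (suc d) add-jl ⟩
        suc d * (suc d * #Avoids S[ suc t ])   ∎
        where
        open ≤-Reasoning
        revealed∪il? : ∀ a b → Dec (Revealed t a b ⊎ Edge i l a b)
        revealed∪il? a b = revealed? t a b ⊎-dec edge? i l a b
        S′ : Constraints
        S′ = S ↾ revealed∪il?
        l≢i : l ≢ i
        l≢i l≡i = l∉I (subst (_∈ I) (sym l≡i) i∈I)
        l≢j : l ≢ j
        l≢j l≡j = l∉I (subst (_∈ I) (sym l≡j) j∈I)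
        add-il : d * #Avoids S[ t ] ≤ suc d * #Avoids S′
        add-il = grow (revealed? t) revealed∪il? (l≢i ∘ sym)
          (proj₁ (not-yet-revealed l≡t i∈I)) (proj₂ (not-yet-revealed l≡t i∈I))
          λ f avoids adj → Avoids-↾⁺ S revealed∪il? λ where
            a b s (inj₁ revealed)             → Avoids-↾⁻ S (revealed? t) avoids a b s revealed
            a b s (inj₂ (inj₁ (refl , refl))) → adj (inj₁ s)
            a b s (inj₂ (inj₂ (refl , refl))) → Adj-sym (adj (inj₂ s))
        add-jl : d * #Avoids S′ ≤ suc d * #Avoids S[ suc t ]
        add-jl = grow revealed∪il? (revealed? (suc t)) (l≢j ∘ sym)
          [ proj₁ (not-yet-revealed l≡t j∈I) , [ (λ (j≡i , _) → i≢j (sym j≡i)) , (λ (j≡l , _) → l≢j (sym j≡l)) ]′ ]′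
          [ proj₂ (not-yet-revealed l≡t j∈I) , [ (λ (l≡i , _) → l≢i l≡i) , (λ (_ , j≡i) → i≢j (sym j≡i)) ]′ ]′
          λ f avoids adj → Avoids-↾⁺ S (revealed? (suc t)) λ a b s revealed → case revealed? t a b of λ where
            (yes revealed′) → Avoids-↾⁻ S revealed∪il? avoids a b s (inj₁ revealed′)
            (no ¬revealed)  → case newly-revealed l≡t revealed ¬revealed of λ where
              (inj₁ (a∈I , refl)) → case ∈I⁻ a∈I of λ where
                (inj₁ refl) → Avoids-↾⁻ S revealed∪il? avoids a b s (inj₂ (inj₁ (refl , refl)))
                (inj₂ refl) → adj (inj₁ s)
              (inj₂ (b∈I , refl)) → case ∈I⁻ b∈I of λ where
                (inj₁ refl) → Avoids-↾⁻ S revealed∪il? avoids a b s (inj₂ (inj₂ (refl , refl)))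
                (inj₂ refl) → Adj-sym (adj (inj₂ s))

      index∈I⇔ : ∀ {l t} → toℕ l ≡ t → T ((toℕ i ≡ᵇ t) ∨ (toℕ j ≡ᵇ t)) ⇔ l ∈ I
      index∈I⇔ {l} {t} l≡t = mk⇔ to from
        where
        at : ∀ {p} → p ∈ I → T (toℕ p ≡ᵇ t) → l ∈ I
        at p∈I p≡ᵇt = subst (_∈ I) (toℕ-injective (trans (≡ᵇ⇒≡ _ _ p≡ᵇt) (sym l≡t))) p∈I
        to : T ((toℕ i ≡ᵇ t) ∨ (toℕ j ≡ᵇ t)) → l ∈ I
        to i∨j = [ at i∈I , at j∈I ]′ (Equivalence.to T-∨ i∨j)
        from : l ∈ I → T ((toℕ i ≡ᵇ t) ∨ (toℕ j ≡ᵇ t))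
        from l∈I = Equivalence.from (T-∨ {toℕ i ≡ᵇ t})
          (Sum.map (λ { refl → ≡⇒≡ᵇ _ _ l≡t }) (λ { refl → ≡⇒≡ᵇ _ _ l≡t }) (∈I⁻ l∈I))

      cost : ℕ → ℕ
      cost zero    = 0
      cost (suc t) = (if (toℕ i ≡ᵇ t) ∨ (toℕ j ≡ᵇ t) then 0 else 2) + cost t

      chain : NoConstraintInside → ∀ {t} → t ≤ r → d ^ cost t * #Avoids S[ 0 ] ≤ suc d ^ cost t * #Avoids S[ t ]
      chain none {zero}  _   = ≤-refl
      chain none {suc t} t<r with (toℕ i ≡ᵇ t) ∨ (toℕ j ≡ᵇ t) in t∈I
      ... | true  = ≤-trans (chain none (<⇒≤ t<r))
        (*-monoʳ-≤ (suc d ^ cost t) (count-mono (Avoids? S[ t ]) (Avoids? S[ suc t ])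
          (reveal-inside l≡t (Equivalence.to (index∈I⇔ l≡t) (Equivalence.from T-≡ t∈I)) none)))
        where
        l≡t : toℕ (fromℕ< t<r) ≡ t
        l≡t = toℕ-fromℕ< t<r
      ... | false = begin
        d * (d * d ^ c) * #Avoids S[ 0 ]               ≡⟨ rearrange d (d ^ c) (#Avoids S[ 0 ]) ⟩
        d * (d * (d ^ c * #Avoids S[ 0 ]))             ≤⟨ *-monoʳ-≤ d (*-monoʳ-≤ d (chain none (<⇒≤ t<r))) ⟩
        d * (d * (D ^ c * #Avoids S[ t ]))             ≡⟨ cong (d *_) (x∙yz≈y∙xz d (D ^ c) _) ⟩
        d * (D ^ c * (d * #Avoids S[ t ]))             ≡⟨ x∙yz≈y∙xz d (D ^ c) _ ⟩
        D ^ c * (d * (d * #Avoids S[ t ]))             ≤⟨ *-monoʳ-≤ (D ^ c) (reveal-outside l≡t l∉I) ⟩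
        D ^ c * (D * (D * #Avoids S[ suc t ]))         ≡⟨ x∙yz≈y∙xz (D ^ c) D _ ⟩
        D * (D ^ c * (D * #Avoids S[ suc t ]))         ≡⟨ cong (D *_) (x∙yz≈y∙xz (D ^ c) D _) ⟩
        D * (D * (D ^ c * #Avoids S[ suc t ]))         ≡⟨ rearrange D (D ^ c) (#Avoids S[ suc t ]) ⟨
        D * (D * D ^ c) * #Avoids S[ suc t ]           ∎
        where
        open ≤-Reasoning
        c = cost t
        D = suc d
        l≡t : toℕ (fromℕ< t<r) ≡ t
        l≡t = toℕ-fromℕ< t<r
        l∉I : fromℕ< t<r ∉ I
        l∉I l∈I = subst T t∈I (Equivalence.from (index∈I⇔ l≡t) l∈I)
        rearrange : ∀ x y z → x * (x * y) * z ≡ x * (x * (y * z))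
        rearrange = solve-∀

      weight : ∀ t → (if (toℕ i ≡ᵇ t) ∨ (toℕ j ≡ᵇ t) then 0 else 2) + 2 * (𝟙 (toℕ i ≡ᵇ t) + 𝟙 (toℕ j ≡ᵇ t)) ≡ 2
      weight t with toℕ i ≡ᵇ t in i≡ᵇt | toℕ j ≡ᵇ t in j≡ᵇt
      ... | true  | true  = contradiction (toℕ-injective (trans (≡ᵇ⇒≡ _ _ (Equivalence.from T-≡ i≡ᵇt))
                                                               (sym (≡ᵇ⇒≡ _ _ (Equivalence.from T-≡ j≡ᵇt))))) i≢j
      ... | true  | false = refl
      ... | false | true  = refl
      ... | false | false = refl

      cost+passed : ∀ t → cost t + 2 * (𝟙 (toℕ i <ᵇ t) + 𝟙 (toℕ j <ᵇ t)) ≡ 2 * t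
      cost+passed zero    = refl
      cost+passed (suc t) = begin
        w + cost t + 2 * (𝟙 (toℕ i <ᵇ suc t) + 𝟙 (toℕ j <ᵇ suc t))
          ≡⟨ cong₂ (λ x y → w + cost t + 2 * (x + y)) (𝟙-<ᵇ-suc (toℕ i) t) (𝟙-<ᵇ-suc (toℕ j) t) ⟩
        w + cost t + 2 * ((𝟙 (toℕ i ≡ᵇ t) + 𝟙 (toℕ i <ᵇ t)) + (𝟙 (toℕ j ≡ᵇ t) + 𝟙 (toℕ j <ᵇ t)))
          ≡⟨ regroup w (cost t) (𝟙 (toℕ i ≡ᵇ t)) (𝟙 (toℕ i <ᵇ t)) (𝟙 (toℕ j ≡ᵇ t)) (𝟙 (toℕ j <ᵇ t)) ⟩
        (w + 2 * (𝟙 (toℕ i ≡ᵇ t) + 𝟙 (toℕ j ≡ᵇ t))) + (cost t + 2 * (𝟙 (toℕ i <ᵇ t) + 𝟙 (toℕ j <ᵇ t)))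
          ≡⟨ cong₂ _+_ (weight t) (cost+passed t) ⟩
        2 + 2 * t
          ≡⟨ *-distribˡ-+ 2 1 t ⟨
        2 * suc t ∎
        where
        open ≡-Reasoning
        w = if (toℕ i ≡ᵇ t) ∨ (toℕ j ≡ᵇ t) then 0 else 2
        regroup : ∀ w c a b e g → w + c + 2 * ((a + b) + (e + g)) ≡ (w + 2 * (a + e)) + (c + 2 * (b + g))
        regroup = solve-∀

      cost-total : cost r ≡ d
      cost-total = +-cancelʳ-≡ 4 (cost r) d (begin
        cost r + 2 * (1 + 1)
          ≡⟨ cong (λ x → cost r + 2 * x) (cong₂ _+_ (passed i) (passed j)) ⟨
        cost r + 2 * (𝟙 (toℕ i <ᵇ r) + 𝟙 (toℕ j <ᵇ r))
          ≡⟨ cost+passed r ⟩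
        2 * r
          ≡⟨ 2r≡d+4 ⟩
        d + 4 ∎)
        where
        open ≡-Reasoning
        passed : ∀ p → 𝟙 (toℕ p <ᵇ r) ≡ 1
        passed p = cong 𝟙 (Equivalence.to T-≡ (<⇒<ᵇ (toℕ<n p)))

      [d/1+d]^d-bound : NoConstraintInside → d ^ d * #Avoids S[ 0 ] ≤ suc d ^ d * #Avoids S
      [d/1+d]^d-bound none = begin
        d ^ d * #Avoids S[ 0 ]            ≡⟨ cong (λ c → d ^ c * #Avoids S[ 0 ]) cost-total ⟨
        d ^ cost r * #Avoids S[ 0 ]       ≤⟨ chain none ≤-refl ⟩
        suc d ^ cost r * #Avoids S[ r ]   ≡⟨ cong (λ c → suc d ^ c * #Avoids S[ r ]) cost-total ⟩
        suc d ^ d * #Avoids S[ r ]        ≤⟨ *-monoʳ-≤ (suc d ^ d) #Avoids-S[r]≤#Avoids-S ⟩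
        suc d ^ d * #Avoids S             ∎
        where
        open ≤-Reasoning
        #Avoids-S[r]≤#Avoids-S : #Avoids S[ r ] ≤ #Avoids S
        #Avoids-S[r]≤#Avoids-S = count-mono (Avoids? S[ r ]) (Avoids? S) λ f avoids a b s →
          Avoids-↾⁻ S (revealed? r) avoids a b s ((λ _ → toℕ<n b) , (λ _ → toℕ<n a))

      k²*#Bad≡nonEdges*#Avoids : k * k * #Bad S[ 0 ] i j ≡ nonEdges i j * #Avoids S[ 0 ]
      k²*#Bad≡nonEdges*#Avoids = *-cancelˡ-≡ _ _ (k ^ r) {{m^n≢0 k r {{>-nonZero k≥1}}}} (begin
        k ^ r * (k * k * #Bad S[ 0 ] i j)         ≡⟨ x∙yz≈y∙xz (k ^ r) (k * k) _ ⟩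
        k * k * (k ^ r * #Bad S[ 0 ] i j)         ≡⟨ cong (λ x → k * k * (k ^ r * x)) #Bad≡ΣFH ⟩
        k * k * (k ^ r * ΣΩ r (λ f → F f * H f))  ≡⟨ cong (k * k *_) (ΣΩ-independent I F H F∼ H∼) ⟩
        k * k * (ΣΩ r F * #Avoids S[ 0 ])         ≡⟨ *-assoc (k * k) _ _ ⟨
        k * k * ΣΩ r F * #Avoids S[ 0 ]           ≡⟨ cong (_* #Avoids S[ 0 ]) (ΣΩ-pair r i≢j nonAdj) ⟩
        k ^ r * nonEdges i j * #Avoids S[ 0 ]     ≡⟨ *-assoc (k ^ r) _ _ ⟩
        k ^ r * (nonEdges i j * #Avoids S[ 0 ])   ∎)
        where
        open ≡-Reasoning
        nonAdj : Fin k → Fin k → ℕ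
        nonAdj a b = 𝟙 (not (adj G (i , a) (j , b)))
        F H : Choice → ℕ
        F f = nonAdj (f i) (f j)
        H f = 𝟙 (does (Avoids? S[ 0 ] f))
        #Bad≡ΣFH : #Bad S[ 0 ] i j ≡ ΣΩ r (λ f → F f * H f)
        #Bad≡ΣFH = ΣΩ-cong r λ f → trans (𝟙-∧ (does (Avoids? S[ 0 ] f)) _) (*-comm (H f) (F f))
        F∼ : DependsOn I F
        F∼ f g f≈g = cong₂ nonAdj (f≈g i∈I) (f≈g j∈I)
        outside-I : ∀ {a b} → Revealed 0 a b → a ∈ Subset.∁ I × b ∈ Subset.∁ I
        outside-I (a∈I→b<0 , b∈I→a<0) = x∉p⇒x∈∁p (n≮0 ∘ a∈I→b<0) , x∉p⇒x∈∁p (n≮0 ∘ b∈I→a<0)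
        transfer : ∀ {f g} → (∀ {x} → x ∈ Subset.∁ I → f x ≡ g x) → Avoids S[ 0 ] f → Avoids S[ 0 ] g
        transfer {f} {g} f≈g avoids = Avoids-↾⁺ S (revealed? 0) λ a b s revealed →
          let a∉I , b∉I = outside-I revealed in
          subst₂ (λ x y → T (adj G (a , x) (b , y))) (f≈g a∉I) (f≈g b∉I)
                 (Avoids-↾⁻ S (revealed? 0) avoids a b s revealed)
        H∼ : DependsOn (Subset.∁ I) H
        H∼ f g f≈g = cong 𝟙 (does-⇔ (mk⇔ (transfer f≈g) (transfer (sym ∘ f≈g))) (Avoids? S[ 0 ] f) (Avoids? S[ 0 ] g))

      claim-without-inside : NoConstraintInside → suc d * #Bad S i j ≤ #Avoids S
      claim-without-inside none = *-cancelˡ-≤ K {{K≢0}} (begin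
        K * (suc d * #Bad S i j)                        ≤⟨ *-monoʳ-≤ K (*-monoʳ-≤ (suc d) #Bad≤#Bad₀) ⟩
        K * (suc d * #Bad S[ 0 ] i j)                   ≡⟨ rearrange (k * k) (d ^ d) (suc d) _ ⟩
        suc d * d ^ d * (k * k * #Bad S[ 0 ] i j)       ≡⟨ cong (suc d * d ^ d *_) k²*#Bad≡nonEdges*#Avoids ⟩
        suc d * d ^ d * (nonEdges i j * #Avoids S[ 0 ]) ≡⟨ rearrange′ (suc d) (d ^ d) (nonEdges i j) _ ⟩
        suc d * nonEdges i j * (d ^ d * #Avoids S[ 0 ]) ≤⟨ *-monoʳ-≤ (suc d * nonEdges i j) ([d/1+d]^d-bound none) ⟩
        suc d * nonEdges i j * (suc d ^ d * #Avoids S)  ≡⟨ rearrange″ (suc d) (nonEdges i j) (suc d ^ d) _ ⟩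
        suc d ^ suc d * nonEdges i j * #Avoids S        ≤⟨ *-monoˡ-≤ (#Avoids S) (sparse i j i≢j) ⟩
        K * #Avoids S                                   ∎)
        where
        open ≤-Reasoning
        K = k * k * d ^ d
        K≢0 : NonZero K
        K≢0 = >-nonZero (*-mono-< (*-mono-≤ k≥1 k≥1) (m^n>0 d {{>-nonZero d≥1}} d))
        #Bad≤#Bad₀ : #Bad S i j ≤ #Bad S[ 0 ] i j
        #Bad≤#Bad₀ = count-mono (Bad? S i j) (Bad? S[ 0 ] i j)
          (λ f (avoids , ¬adj) → Avoids-↾ S (revealed? 0) avoids , ¬adj)
        rearrange : ∀ q e D b → q * e * (D * b) ≡ D * e * (q * b)
        rearrange = solve-∀
        rearrange′ : ∀ D e m n → D * e * (m * n) ≡ D * m * (e * n)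
        rearrange′ = solve-∀
        rearrange″ : ∀ D m p n → D * m * (p * n) ≡ D * p * m * n
        rearrange″ = solve-∀

      claim-with-inside : ∀ {a b} → a ∈ I → b ∈ I → T (S a b) → suc d * #Bad S i j ≤ #Avoids S
      claim-with-inside {a} {b} a∈I b∈I s =
        subst (_≤ #Avoids S) (sym (trans (cong (suc d *_) #Bad≡0) (*-zeroʳ (suc d)))) z≤n
        where
        #Bad≡0 : #Bad S i j ≡ 0
        #Bad≡0 = count-none (Bad? S i j) λ f (avoids , ¬adj) → case ∈I⁻ a∈I , ∈I⁻ b∈I of λ where
          (inj₁ refl , inj₁ refl) → Adj-irrefl {f} (avoids a b s)
          (inj₁ refl , inj₂ refl) → ¬adj (avoids a b s)
          (inj₂ refl , inj₁ refl) → ¬adj (Adj-sym {f} (avoids a b s))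
          (inj₂ refl , inj₂ refl) → Adj-irrefl {f} (avoids a b s)

  claim : ∀ S → Claim d S
  claim = size-rec (Claim d) λ S ih i j i≢j →
    let open InductionStep S ih
        open Neighbourhood i j i≢j
    in case any? (λ a → any? (λ b → (a ∈? I) ×-dec (b ∈? I) ×-dec T? (S a b))) of λ where
      (yes (a , b , a∈I , b∈I , s)) → claim-with-inside a∈I b∈I s
      (no ∄)                        → claim-without-inside (λ a b a∈I b∈I s → ∄ (a , b , a∈I , b∈I , s))

  #Avoids-positive : ∀ S → (∀ a → ¬ T (S a a)) → 0 < #Avoids S
  #Avoids-positive = size-rec _ step
    where
    step : ∀ S → (∀ U → size U < size S → (∀ a → ¬ T (U a a)) → 0 < #Avoids U) →
           (∀ a → ¬ T (S a a)) → 0 < #Avoids S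
    step S ih irreflexive with any? (λ a → any? (λ b → T? (S a b)))
    ... | no ∄ = subst (0 <_) (sym (count-all (Avoids? S) (λ f a b s → contradiction (a , b , s) ∄)))
                                (m^n>0 k {{>-nonZero k≥1}} r)
    ... | yes (a , b , s) = >-nonZero⁻¹ (#Avoids S) {{m*n≢0⇒n≢0 (suc d) {{>-nonZero 0<[1+d]*#Avoids-S}}}}
      where
      not-ab? : ∀ x y → Dec (¬ (x ≡ a × y ≡ b))
      not-ab? x y = ¬? ((x ≟ a) ×-dec (y ≟ b))
      U : Constraints
      U = S ↾ not-ab?
      a≢b : a ≢ b
      a≢b refl = irreflexive a s
      0<#Avoids-U : 0 < #Avoids U
      0<#Avoids-U = ih U (size-↾< S not-ab? s (λ ¬ab → ¬ab (refl , refl)))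
                         (λ x u → irreflexive x (proj₁ (↾⁻ S not-ab? u)))
      extend : ∀ f → Avoids U f → Adj f a b → Avoids S f
      extend f avoids adj x y s′ with (x ≟ a) ×-dec (y ≟ b)
      ... | yes (refl , refl) = adj
      ... | no  ≢ab           = Avoids-↾⁻ S not-ab? avoids x y s′ ≢ab
      0<[1+d]*#Avoids-S : 0 < suc d * #Avoids S
      0<[1+d]*#Avoids-S = <-≤-trans (*-mono-< d≥1 0<#Avoids-U) (claim-step d U S (claim U) a≢b extend)

  distinct? : ∀ (a b : Fin r) → Dec (a ≢ b)
  distinct? a b = ¬? (a ≟ b)

  complete : Constraints
  complete = (λ _ _ → true) ↾ distinct?

  inducedK : HasInducedK G r
  inducedK with count-positive (Avoids? complete)
                  (#Avoids-positive complete (λ a t → proj₂ (↾⁻ (λ _ _ → true) distinct? {a} {a} t) refl))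
  ... | f , avoids = complete⇒inducedK f (λ x y → Avoids-↾⁻ (λ _ _ → true) distinct? avoids x y tt)

two-parts-inducedK : ∀ {k} (G : PartiteGraph 2 k) → 0 < edgesBetween G zero (suc zero) → HasInducedK G 2
two-parts-inducedK G edges>0 with sumFin-positive _ _ edges>0
... | a , row>0 with sumFin-positive _ _ row>0
... | b , 𝟙>0 = complete⇒inducedK f all-adjacent
  where
  open Choices G
  f : Choice
  f = a ∷ b ∷ []
  adjacent : Adj f zero (suc zero)
  adjacent = 𝟙>0⇒T _ 𝟙>0
  all-adjacent : ∀ x y → x ≢ y → Adj f x y
  all-adjacent zero       zero       0≢0 = contradiction refl 0≢0
  all-adjacent zero       (suc zero) _   = adjacent
  all-adjacent (suc zero) zero       _   = Adj-sym {f} adjacent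
  all-adjacent (suc zero) (suc zero) 1≢1 = contradiction refl 1≢1

m+4∸3≡1+m : ∀ m → m + 4 ∸ 3 ≡ suc m
m+4∸3≡1+m m = trans (+-∸-assoc m (s≤s (s≤s (s≤s z≤n)))) (+-comm m 1)

lemma3p3 : (r k : ℕ) → 2 ≤ r → 1 ≤ k → (G : PartiteGraph r k) →
    (∀ (i j : Fin r) → i ≢ j →
    e* ((2 * r ∸ 3) * (k * k ∸ edgesBetween G i j)) < (k * k)) →
    HasInducedK G r
lemma3p3 (suc zero) _ (s≤s ()) _ _ _
lemma3p3 (suc (suc zero)) k _ _ G dense = two-parts-inducedK G
  (edges>0 (edgesBetween G zero (suc zero)) (e*a<b⇒a<b _ (k * k) (dense zero (suc zero) (λ ()))))
  where
  edges>0 : ∀ e → 1 * (k * k ∸ e) < k * k → 0 < e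
  edges>0 zero    k²<k² = contradiction (subst (_< k * k) (*-identityˡ (k * k)) k²<k²) (<-irrefl refl)
  edges>0 (suc _) _     = z<s
lemma3p3 r@(suc (suc (suc r′))) k _ k≥1 G dense = LocalLemma.inducedK G d k≥1 (s≤s z≤n) 2r≡d+4 sparse
  where
  open Choices G using (nonEdges; nonEdges≡k²∸edgesBetween)
  d = 2 + 2 * r′
  2r≡d+4 : 2 * r ≡ d + 4
  2r≡d+4 = expand r′
    where
    expand : ∀ x → 2 * (3 + x) ≡ (2 + 2 * x) + 4
    expand = solve-∀
  sparse : ∀ i j → i ≢ j → suc d ^ suc d * nonEdges i j ≤ k * k * d ^ d
  sparse i j i≢j rewrite nonEdges≡k²∸edgesBetween i j = [1+d]^[1+d]*m≤K*d^d d _ (k * k)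
    (subst (λ D → e* (D * (k * k ∸ edgesBetween G i j)) < (k * k)) (trans (cong (_∸ 3) 2r≡d+4) (m+4∸3≡1+m d))
           (dense i j i≢j))
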